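{- For every odd integer $k \ge 3$, $\mathrm{eqdim}(J_{2k,k}) = \frac{1}{2}\binom{2k}{k}$.
   Context: For positive integers $n > k$, the Johnson graph $J_{n,k}$ has as vertices all $k$-element subsets of $\{1,\dots,n\}$, two such subsets $A,B$ being adjacent iff $|A \cap B| = k-1$. In a connected graph $G$, $d(u,v)$ is the shortest-path distance. A subset $S \subseteq V(G)$ is a distance-equalizer set of $G$ if for every two distinct vertices $u,v \in V(G)\setminus S$ there exists $x \in S$ with $d(u,x) = d(v,x)$. The equidistant dimension $\mathrm{eqdim}(G)$ is the minimum cardinality of a distance-equalizer set of $G$. -}

module Defs where

open import Data.Nat using (ℕ; zero; suc; _≤_; _∸_)
open import Data.Fin.Subset using (Subset; _∩_; ∣_∣)
open import Data.Product using (Σ; Σ-syntax; ∃; ∃-syntax; _×_; _,_)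
open import Data.List using (List; length)
open import Data.List.Membership.Propositional using (_∈_; _∉_)
open import Data.List.Relation.Unary.Unique.Propositional using (Unique)
open import Relation.Binary.PropositionalEquality using (_≡_; _≢_)

record Graph : Set₁ where
  field
    V   : Set
    Adj : V → V → Set

open Graph public

data Walk (G : Graph) : V G → V G → ℕ → Set where
  here : ∀ {u} → Walk G u u 0
  step : ∀ {u w v m} → Adj G u w → Walk G w v m → Walk G u v (suc m)

Dist : (G : Graph) → V G → V G → ℕ → Set
Dist G u v m = Walk G u v m × (∀ m′ → Walk G u v m′ → m ≤ m′)

Johnson : ℕ → ℕ → Graph
Johnson n k = record
  { V   = Σ[ A ∈ Subset n ] ∣ A ∣ ≡ k
  ; Adj = λ { (A , _) (B , _) → ∣ A ∩ B ∣ ≡ k ∸ 1 } }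

IsDistanceEqualizer : (G : Graph) → List (V G) → Set
IsDistanceEqualizer G S =
  ∀ (u v : V G) → u ∉ S → v ∉ S → u ≢ v →
    ∃[ x ] (x ∈ S × ∃[ m ] (Dist G u x m × Dist G v x m))

EqDim : (G : Graph) → ℕ → Set
EqDim G m =
  (∃[ S ] (Unique S × IsDistanceEqualizer G S × length S ≡ m)) ×
  (∀ S → Unique S → IsDistanceEqualizer G S → m ≤ length S)

{-# OPTIONS --safe #-}
-- In J(n,k) the distance is d(A,B) = k − |A ∩ B|. For n = 2k every X meets A and its complement
-- Ā in k points together, so d(A,X) + d(Ā,X) = k; when k is odd no vertex is equidistant from A
-- and Ā, and a distance-equalizer set must contain A or Ā from each of the ½ C(2k,k)
-- complementary pairs. Conversely the ½ C(2k,k) vertices through a fixed point form a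
-- distance-equalizer set: two k-sets U, W avoiding the point are equidistant from {point} ∪ Y as
-- soon as |U ∩ Y| = |W ∩ Y|, and such a Y of the even size k − 1 exists.
module Submission where

open import Defs
open import Data.Nat using (ℕ; _*_; _≤_; _/_; _%_)
open import Data.Nat.Combinatorics using (_C_)
open import Relation.Binary.PropositionalEquality using (_≡_)

open import Data.Bool using (_xor_)
import Data.Bool.Properties as Bool
open import Data.Fin.Subset using (Subset; _∩_; ∁; ∣_∣; inside; outside)
open import Data.Fin.Subset.Properties using (∣p∩q∣≤∣p∣; ∣p∩q∣≤∣q∣; ∩-idem; ∩-comm; ∣∁p∣≡n∸∣p∣)
open import Data.List using (List; []; _∷_; _++_; map; length)
open import Data.List.Properties using (length-map; length-++; length-++-sucʳ)
open import Data.List.Membership.Propositional using (_∈_)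
open import Data.List.Membership.Propositional.Properties using (∈-map⁺; ∈-map⁻; ∈-++⁺ˡ; ∈-++⁺ʳ; ∈-++⁻; ∈-∃++)
open import Data.List.Relation.Binary.Subset.Propositional using (_⊆_)
open import Data.List.Relation.Unary.Any using (here; there)
import Data.List.Relation.Unary.All as All
open import Data.List.Relation.Unary.AllPairs using ([]; _∷_)
open import Data.List.Relation.Unary.Unique.Propositional using (Unique)
import Data.List.Relation.Unary.Unique.Propositional.Properties as Unique
open import Data.Nat using (zero; suc; pred; _+_; _∸_; _⊔_; _<_; z≤n; s≤s; NonZero)
open import Data.Nat.Combinatorics using (nCk+nC[k+1]≡[n+1]C[k+1]; nCk≡nC[n∸k])
open import Data.Nat.DivMod using (m≡m%n+[m/n]*n; m*n/n≡m)
open import Data.Nat.Properties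
open import Algebra.Properties.CommutativeSemigroup +-commutativeSemigroup using (interchange)
open import Data.Product using (Σ-syntax; ∃-syntax; _×_; _,_; proj₁; proj₂)
open import Data.Sum using (_⊎_; inj₁; inj₂; [_,_]′)
open import Data.Vec using ([]; _∷_; zipWith)
open import Data.Vec.Properties using (∷-injectiveˡ; ∷-injectiveʳ; ≡-dec)
open import Function using (_∘_; case_of_)
open import Function.Definitions using (Injective)
open import Relation.Binary.Definitions using (DecidableEquality)
open import Relation.Binary.PropositionalEquality
  using (_≢_; refl; sym; trans; cong; cong₂; subst; subst₂; module ≡-Reasoning)
open import Relation.Nullary using (contradiction; yes; no; map′)

private
  variable
    n : ℕ

m+m≡2*m : ∀ m → m + m ≡ 2 * m
m+m≡2*m m = cong (m +_) (sym (+-identityʳ m))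

∣p∩q∣+∣p∩∁q∣≡∣p∣ : ∀ (p q : Subset n) → ∣ p ∩ q ∣ + ∣ p ∩ ∁ q ∣ ≡ ∣ p ∣
∣p∩q∣+∣p∩∁q∣≡∣p∣ []            []            = refl
∣p∩q∣+∣p∩∁q∣≡∣p∣ (inside  ∷ p) (inside  ∷ q) = cong suc (∣p∩q∣+∣p∩∁q∣≡∣p∣ p q)
∣p∩q∣+∣p∩∁q∣≡∣p∣ (inside  ∷ p) (outside ∷ q) = trans (+-suc _ _) (cong suc (∣p∩q∣+∣p∩∁q∣≡∣p∣ p q))
∣p∩q∣+∣p∩∁q∣≡∣p∣ (outside ∷ p) (_       ∷ q) = ∣p∩q∣+∣p∩∁q∣≡∣p∣ p q

∣p∣⊔∣q∣≤∣p∩q∣⇒p≡q : ∀ (p q : Subset n) → ∣ p ∣ ⊔ ∣ q ∣ ≤ ∣ p ∩ q ∣ → p ≡ q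
∣p∣⊔∣q∣≤∣p∩q∣⇒p≡q []            []            _       = refl
∣p∣⊔∣q∣≤∣p∩q∣⇒p≡q (inside  ∷ p) (inside  ∷ q) (s≤s h) = cong (inside ∷_) (∣p∣⊔∣q∣≤∣p∩q∣⇒p≡q p q h)
∣p∣⊔∣q∣≤∣p∩q∣⇒p≡q (outside ∷ p) (outside ∷ q) h       = cong (outside ∷_) (∣p∣⊔∣q∣≤∣p∩q∣⇒p≡q p q h)
∣p∣⊔∣q∣≤∣p∩q∣⇒p≡q (inside  ∷ p) (outside ∷ q) h       =
  contradiction (≤-trans (m≤m⊔n (suc ∣ p ∣) ∣ q ∣) h) (<⇒≱ (s≤s (∣p∩q∣≤∣p∣ p q)))
∣p∣⊔∣q∣≤∣p∩q∣⇒p≡q (outside ∷ p) (inside  ∷ q) h       =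
  contradiction (≤-trans (m≤n⊔m ∣ p ∣ (suc ∣ q ∣)) h) (<⇒≱ (s≤s (∣p∩q∣≤∣q∣ p q)))

p≢∁p : ∀ (p : Subset (suc n)) → p ≢ ∁ p
p≢∁p (x ∷ p) e = Bool.not-¬ refl (∷-injectiveˡ e)

∁-injective : ∀ {p q : Subset n} → ∁ p ≡ ∁ q → p ≡ q
∁-injective {p = []}    {[]}    _ = refl
∁-injective {p = x ∷ p} {y ∷ q} e =
  cong₂ _∷_ (Bool.not-injective (∷-injectiveˡ e)) (∁-injective (∷-injectiveʳ e))

add-element-of : ∀ (p q : Subset n) → ∣ p ∩ q ∣ < ∣ q ∣ →
  Σ[ p′ ∈ Subset n ] (∣ p′ ∣ ≡ suc ∣ p ∣ × ∣ p ∩ p′ ∣ ≡ ∣ p ∣ × ∣ p′ ∩ q ∣ ≡ suc ∣ p ∩ q ∣)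
add-element-of (outside ∷ p) (inside ∷ q) _ = inside ∷ p , refl , cong ∣_∣ (∩-idem p) , refl
add-element-of (inside ∷ p) (inside ∷ q) (s≤s h) with add-element-of p q h
... | p′ , e₁ , e₂ , e₃ = inside ∷ p′ , cong suc e₁ , cong suc e₂ , cong suc e₃
add-element-of (inside ∷ p) (outside ∷ q) h with add-element-of p q h
... | p′ , e₁ , e₂ , e₃ = inside ∷ p′ , cong suc e₁ , cong suc e₂ , e₃
add-element-of (outside ∷ p) (outside ∷ q) h with add-element-of p q h
... | p′ , e₁ , e₂ , e₃ = outside ∷ p′ , e₁ , e₂ , e₃

remove-element-outside : ∀ (p q : Subset n) → ∣ p ∩ q ∣ < ∣ p ∣ →
  Σ[ p′ ∈ Subset n ] (suc ∣ p′ ∣ ≡ ∣ p ∣ × ∣ p ∩ p′ ∣ ≡ ∣ p′ ∣ × ∣ p′ ∩ q ∣ ≡ ∣ p ∩ q ∣)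
remove-element-outside (inside ∷ p) (outside ∷ q) _ = outside ∷ p , refl , cong ∣_∣ (∩-idem p) , refl
remove-element-outside (inside ∷ p) (inside ∷ q) (s≤s h) with remove-element-outside p q h
... | p′ , e₁ , e₂ , e₃ = inside ∷ p′ , cong suc e₁ , cong suc e₂ , cong suc e₃
remove-element-outside (outside ∷ p) (_ ∷ q) h with remove-element-outside p q h
... | p′ , e₁ , e₂ , e₃ = outside ∷ p′ , e₁ , e₂ , e₃

-- Trade a point of p ─ q for a point of q ─ p: whichever of the two comes first is handled
-- directly, the other by a single addition or removal.
exchange : ∀ (p q : Subset n) → ∣ p ∣ ≡ ∣ q ∣ → ∣ p ∩ q ∣ < ∣ p ∣ →
  Σ[ p′ ∈ Subset n ] (∣ p′ ∣ ≡ ∣ p ∣ × suc ∣ p ∩ p′ ∣ ≡ ∣ p ∣ × ∣ p′ ∩ q ∣ ≡ suc ∣ p ∩ q ∣)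
exchange (inside ∷ p) (inside ∷ q) e (s≤s h) with exchange p q (suc-injective e) h
... | p′ , e₁ , e₂ , e₃ = inside ∷ p′ , cong suc e₁ , cong suc e₂ , cong suc e₃
exchange (outside ∷ p) (outside ∷ q) e h with exchange p q e h
... | p′ , e₁ , e₂ , e₃ = outside ∷ p′ , e₁ , e₂ , e₃
exchange (inside ∷ p) (outside ∷ q) e _
  with add-element-of p q (subst (∣ p ∩ q ∣ <_) e (s≤s (∣p∩q∣≤∣p∣ p q)))
... | p′ , e₁ , e₂ , e₃ = outside ∷ p′ , e₁ , cong suc e₂ , e₃
exchange (outside ∷ p) (inside ∷ q) e _
  with remove-element-outside p q (subst (∣ p ∩ q ∣ <_) (sym e) (s≤s (∣p∩q∣≤∣q∣ p q)))
... | p′ , e₁ , e₂ , e₃ = inside ∷ p′ , e₁ , trans (cong suc e₂) e₁ , cong suc e₃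

∣p∩q∣+∣q∩r∣≤∣q∣+∣p∩r∣ : ∀ (p q r : Subset n) → ∣ p ∩ q ∣ + ∣ q ∩ r ∣ ≤ ∣ q ∣ + ∣ p ∩ r ∣

private
  extend : ∀ a b c d → a + b ≤ c + d → ∀ (p q r : Subset n) →
    (a + ∣ p ∩ q ∣) + (b + ∣ q ∩ r ∣) ≤ (c + ∣ q ∣) + (d + ∣ p ∩ r ∣)
  extend a b c d h p q r =
    subst₂ _≤_ (interchange a b ∣ p ∩ q ∣ ∣ q ∩ r ∣) (interchange c d ∣ q ∣ ∣ p ∩ r ∣)
      (+-mono-≤ h (∣p∩q∣+∣q∩r∣≤∣q∣+∣p∩r∣ p q r))

∣p∩q∣+∣q∩r∣≤∣q∣+∣p∩r∣ []            []            []            = z≤n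
∣p∩q∣+∣q∩r∣≤∣q∣+∣p∩r∣ (inside  ∷ p) (inside  ∷ q) (inside  ∷ r) = extend 1 1 1 1 ≤-refl p q r
∣p∩q∣+∣q∩r∣≤∣q∣+∣p∩r∣ (inside  ∷ p) (inside  ∷ q) (outside ∷ r) = extend 1 0 1 0 ≤-refl p q r
∣p∩q∣+∣q∩r∣≤∣q∣+∣p∩r∣ (inside  ∷ p) (outside ∷ q) (inside  ∷ r) = extend 0 0 0 1 z≤n    p q r
∣p∩q∣+∣q∩r∣≤∣q∣+∣p∩r∣ (inside  ∷ p) (outside ∷ q) (outside ∷ r) = ∣p∩q∣+∣q∩r∣≤∣q∣+∣p∩r∣ p q r
∣p∩q∣+∣q∩r∣≤∣q∣+∣p∩r∣ (outside ∷ p) (inside  ∷ q) (inside  ∷ r) = extend 0 1 1 0 ≤-refl p q r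
∣p∩q∣+∣q∩r∣≤∣q∣+∣p∩r∣ (outside ∷ p) (inside  ∷ q) (outside ∷ r) = extend 0 0 1 0 z≤n    p q r
∣p∩q∣+∣q∩r∣≤∣q∣+∣p∩r∣ (outside ∷ p) (outside ∷ q) (_       ∷ r) = ∣p∩q∣+∣q∩r∣≤∣q∣+∣p∩r∣ p q r

_≐_ : Subset n → Subset n → Subset n
p ≐ q = ∁ (zipWith _xor_ p q)

∣p∩∁q∣+∣q∩∁p∣+∣p≐q∣≡n : ∀ (p q : Subset n) → ∣ p ∩ ∁ q ∣ + ∣ q ∩ ∁ p ∣ + ∣ p ≐ q ∣ ≡ n
∣p∩∁q∣+∣q∩∁p∣+∣p≐q∣≡n []            []            = refl
∣p∩∁q∣+∣q∩∁p∣+∣p≐q∣≡n (inside  ∷ p) (outside ∷ q) = cong suc (∣p∩∁q∣+∣q∩∁p∣+∣p≐q∣≡n p q)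
∣p∩∁q∣+∣q∩∁p∣+∣p≐q∣≡n (outside ∷ p) (inside  ∷ q) =
  trans (cong (_+ ∣ p ≐ q ∣) (+-suc ∣ p ∩ ∁ q ∣ ∣ q ∩ ∁ p ∣)) (cong suc (∣p∩∁q∣+∣q∩∁p∣+∣p≐q∣≡n p q))
∣p∩∁q∣+∣q∩∁p∣+∣p≐q∣≡n (inside  ∷ p) (inside  ∷ q) =
  trans (+-suc _ ∣ p ≐ q ∣) (cong suc (∣p∩∁q∣+∣q∩∁p∣+∣p≐q∣≡n p q))
∣p∩∁q∣+∣q∩∁p∣+∣p≐q∣≡n (outside ∷ p) (outside ∷ q) =
  trans (+-suc _ ∣ p ≐ q ∣) (cong suc (∣p∩∁q∣+∣q∩∁p∣+∣p≐q∣≡n p q))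

choose-by-region : ∀ (p q : Subset n) a b c → a ≤ ∣ p ∩ ∁ q ∣ → b ≤ ∣ q ∩ ∁ p ∣ → c ≤ ∣ p ≐ q ∣ →
  Σ[ r ∈ Subset n ] (∣ r ∣ ≡ a + b + c × ∣ p ∩ r ∣ + b ≡ ∣ q ∩ r ∣ + a)
choose-by-region [] [] _ _ _ z≤n z≤n z≤n = [] , refl , refl
choose-by-region (inside ∷ p) (outside ∷ q) zero b c _ hb hc with choose-by-region p q 0 b c z≤n hb hc
... | r , e₁ , e₂ = outside ∷ r , e₁ , e₂
choose-by-region (inside ∷ p) (outside ∷ q) (suc a) b c (s≤s ha) hb hc with choose-by-region p q a b c ha hb hc
... | r , e₁ , e₂ = inside ∷ r , cong suc e₁ , trans (cong suc e₂) (sym (+-suc _ a))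
choose-by-region (outside ∷ p) (inside ∷ q) a zero c ha _ hc with choose-by-region p q a 0 c ha z≤n hc
... | r , e₁ , e₂ = outside ∷ r , e₁ , e₂
choose-by-region (outside ∷ p) (inside ∷ q) a (suc b) c ha (s≤s hb) hc with choose-by-region p q a b c ha hb hc
... | r , e₁ , e₂ = inside ∷ r , trans (cong suc e₁) (cong (_+ c) (sym (+-suc a b))) , trans (+-suc _ b) (cong suc e₂)
choose-by-region (inside ∷ p) (inside ∷ q) a b zero ha hb _ with choose-by-region p q a b 0 ha hb z≤n
... | r , e₁ , e₂ = outside ∷ r , e₁ , e₂
choose-by-region (inside ∷ p) (inside ∷ q) a b (suc c) ha hb (s≤s hc) with choose-by-region p q a b c ha hb hc
... | r , e₁ , e₂ = inside ∷ r , trans (cong suc e₁) (sym (+-suc _ c)) , cong suc e₂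
choose-by-region (outside ∷ p) (outside ∷ q) a b zero ha hb _ with choose-by-region p q a b 0 ha hb z≤n
... | r , e₁ , e₂ = outside ∷ r , e₁ , e₂
choose-by-region (outside ∷ p) (outside ∷ q) a b (suc c) ha hb (s≤s hc) with choose-by-region p q a b c ha hb hc
... | r , e₁ , e₂ = inside ∷ r , trans (cong suc e₁) (sym (+-suc _ c)) , e₂

-- If t = ∣ p ─ q ∣ = ∣ q ─ p ∣ is small, take all of both differences and fill up with points of
-- agreement; otherwise take h points from each difference.
equalizing-subset : ∀ (p q : Subset n) h → ∣ p ∣ ≡ ∣ q ∣ → 2 * h ≤ n →
  Σ[ r ∈ Subset n ] (∣ r ∣ ≡ 2 * h × ∣ p ∩ r ∣ ≡ ∣ q ∩ r ∣)
equalizing-subset {n} p q h ∣p∣≡∣q∣ 2h≤n = [ few-differences , many-differences ]′ (≤-total t h)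
  where
  open ≡-Reasoning
  t : ℕ
  t = ∣ p ∩ ∁ q ∣

  t≡∣q∩∁p∣ : t ≡ ∣ q ∩ ∁ p ∣
  t≡∣q∩∁p∣ = +-cancelˡ-≡ (∣ p ∩ q ∣) t (∣ q ∩ ∁ p ∣) (begin
    ∣ p ∩ q ∣ + t             ≡⟨ ∣p∩q∣+∣p∩∁q∣≡∣p∣ p q ⟩
    ∣ p ∣                     ≡⟨ ∣p∣≡∣q∣ ⟩
    ∣ q ∣                     ≡⟨ ∣p∩q∣+∣p∩∁q∣≡∣p∣ q p ⟨
    ∣ q ∩ p ∣ + ∣ q ∩ ∁ p ∣   ≡⟨ cong (λ s → ∣ s ∣ + ∣ q ∩ ∁ p ∣) (∩-comm q p) ⟩
    ∣ p ∩ q ∣ + ∣ q ∩ ∁ p ∣   ∎)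

  t+t+∣p≐q∣≡n : t + t + ∣ p ≐ q ∣ ≡ n
  t+t+∣p≐q∣≡n = trans (cong (λ s → t + s + ∣ p ≐ q ∣) t≡∣q∩∁p∣) (∣p∩∁q∣+∣q∩∁p∣+∣p≐q∣≡n p q)

  few-differences : t ≤ h → Σ[ r ∈ Subset n ] (∣ r ∣ ≡ 2 * h × ∣ p ∩ r ∣ ≡ ∣ q ∩ r ∣)
  few-differences t≤h =
    let r , ∣r∣≡ , balanced = choose-by-region p q t t (2 * h ∸ (t + t))
                                ≤-refl (≤-reflexive t≡∣q∩∁p∣) fill≤∣p≐q∣
    in r , trans ∣r∣≡ (m+[n∸m]≡n t+t≤2h) , +-cancelʳ-≡ t _ _ balanced
    where
    t+t≤2h : t + t ≤ 2 * h
    t+t≤2h = subst (_≤ 2 * h) (sym (m+m≡2*m t)) (*-monoʳ-≤ 2 t≤h)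
    fill≤∣p≐q∣ : 2 * h ∸ (t + t) ≤ ∣ p ≐ q ∣
    fill≤∣p≐q∣ = m≤n+o⇒m∸n≤o (2 * h) (t + t) (subst (2 * h ≤_) (sym t+t+∣p≐q∣≡n) 2h≤n)

  many-differences : h ≤ t → Σ[ r ∈ Subset n ] (∣ r ∣ ≡ 2 * h × ∣ p ∩ r ∣ ≡ ∣ q ∩ r ∣)
  many-differences h≤t =
    let r , ∣r∣≡ , balanced = choose-by-region p q h h 0 h≤t (≤-trans h≤t (≤-reflexive t≡∣q∩∁p∣)) z≤n
    in r , trans ∣r∣≡ (trans (+-identityʳ (h + h)) (m+m≡2*m h)) , +-cancelʳ-≡ h _ _ balanced

Unique⇒length≤ : ∀ {A : Set} {xs ys : List A} → Unique xs → xs ⊆ ys → length xs ≤ length ys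
Unique⇒length≤ {xs = []} _ _ = z≤n
Unique⇒length≤ {xs = x ∷ xs} (x∉xs ∷ unique) x∷xs⊆ys with ∈-∃++ (x∷xs⊆ys (here refl))
... | ys₁ , ys₂ , refl =
  subst (suc (length xs) ≤_) (sym (length-++-sucʳ ys₁ x ys₂)) (s≤s (Unique⇒length≤ unique xs⊆ys₁++ys₂))
  where
  xs⊆ys₁++ys₂ : xs ⊆ ys₁ ++ ys₂
  xs⊆ys₁++ys₂ y∈xs with ∈-++⁻ ys₁ (x∷xs⊆ys (there y∈xs))
  ... | inj₁ y∈ys₁         = ∈-++⁺ˡ y∈ys₁
  ... | inj₂ (here refl)   = contradiction refl (All.lookup x∉xs y∈xs)
  ... | inj₂ (there y∈ys₂) = ∈-++⁺ʳ ys₁ y∈ys₂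

module _ {A B : Set} {ι ι′ : A → B}
  (ι-injective : Injective _≡_ _≡_ ι) (ι′-injective : Injective _≡_ _≡_ ι′)
  (ι≢ι′ : ∀ a b → ι a ≢ ι′ b)
  where

  private
    Represents : B → A → Set
    Represents v a = v ≡ ι a ⊎ v ≡ ι′ a

    represents-unique : ∀ {v a b} → Represents v a → Represents v b → a ≡ b
    represents-unique (inj₁ refl) (inj₁ e) = ι-injective e
    represents-unique (inj₁ refl) (inj₂ e) = contradiction e (ι≢ι′ _ _)
    represents-unique (inj₂ refl) (inj₁ e) = contradiction (sym e) (ι≢ι′ _ _)
    represents-unique (inj₂ refl) (inj₂ e) = ι′-injective e

  length≤pair-transversal : ∀ {xs} → Unique xs → (S : List B) → (∀ a → ι a ∈ S ⊎ ι′ a ∈ S) →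
    length xs ≤ length S
  length≤pair-transversal {xs} unique S meets =
    subst (_≤ length S) (length-map chosen xs)
      (Unique⇒length≤ (Unique.map⁺ chosen-injective unique) chosen∈S)
    where
    choice : ∀ a → Σ[ v ∈ B ] (v ∈ S × Represents v a)
    choice a = [ (λ ι∈S → ι a , ι∈S , inj₁ refl) , (λ ι′∈S → ι′ a , ι′∈S , inj₂ refl) ]′ (meets a)

    chosen : A → B
    chosen = proj₁ ∘ choice

    chosen-injective : Injective _≡_ _≡_ chosen
    chosen-injective {a} {b} e =
      represents-unique (proj₂ (proj₂ (choice a)))
        (subst (λ v → Represents v b) (sym e) (proj₂ (proj₂ (choice b))))

    chosen∈S : map chosen xs ⊆ S
    chosen∈S v∈ with ∈-map⁻ chosen v∈
    ... | a , _ , refl = proj₁ (proj₂ (choice a))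

Dist-unique : ∀ {G u v m m′} → Dist G u v m → Dist G u v m′ → m ≡ m′
Dist-unique (walk , minimal) (walk′ , minimal′) = ≤-antisym (minimal _ walk′) (minimal′ _ walk)

module DistanceCharacterisation
  (G : Graph) (ρ : V G → V G → ℕ)
  (ρ-refl : ∀ u → ρ u u ≡ 0)
  (ρ≡0⇒≡ : ∀ u v → ρ u v ≡ 0 → u ≡ v)
  (ρ-descent : ∀ u v {m} → ρ u v ≡ suc m → ∃[ w ] (Adj G u w × ρ w v ≡ m))
  (ρ-lipschitz : ∀ u w v → Adj G u w → ρ u v ≤ suc (ρ w v))
  where

  walk-of-length-ρ : ∀ m u v → ρ u v ≡ m → Walk G u v m
  walk-of-length-ρ zero    u v ρ≡0   = subst (λ w → Walk G u w 0) (ρ≡0⇒≡ u v ρ≡0) here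
  walk-of-length-ρ (suc m) u v ρ≡m+1 =
    let w , u~w , ρ≡m = ρ-descent u v ρ≡m+1 in step u~w (walk-of-length-ρ m w v ρ≡m)

  ρ≤walk-length : ∀ {u v m} → Walk G u v m → ρ u v ≤ m
  ρ≤walk-length {u}     here                     = ≤-reflexive (ρ-refl u)
  ρ≤walk-length {u} {v} (step {w = w} u~w walk) =
    ≤-trans (ρ-lipschitz u w v u~w) (s≤s (ρ≤walk-length walk))

  ρ-is-distance : ∀ u v → Dist G u v (ρ u v)
  ρ-is-distance u v = walk-of-length-ρ _ u v refl , λ _ → ρ≤walk-length

private
  ∸-lipschitz : ∀ k {a b} → (k ∸ 1) + b ≤ k + a → k ∸ a ≤ suc (k ∸ b)
  ∸-lipschitz zero    {a}     _ = ≤-trans (≤-reflexive (0∸n≡0 a)) z≤n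
  ∸-lipschitz (suc k) {a} {b} h = m≤n+o⇒m∸n≤o (suc k) a (begin
    suc k                ≤⟨ m≤n+m∸n (suc k) b ⟩
    b + (suc k ∸ b)      ≤⟨ +-monoˡ-≤ (suc k ∸ b) b≤1+a ⟩
    suc a + (suc k ∸ b)  ≡⟨ +-suc a (suc k ∸ b) ⟨
    a + suc (suc k ∸ b)  ∎)
    where
    open ≤-Reasoning
    b≤1+a : b ≤ suc a
    b≤1+a = +-cancelˡ-≤ k b (suc a) (subst (k + b ≤_) (sym (+-suc k a)) h)

KSubset : ℕ → ℕ → Set
KSubset n k = V (Johnson n k)

vertex-≡ : ∀ {k} {A B : KSubset n k} → proj₁ A ≡ proj₁ B → A ≡ B
vertex-≡ {A = A , ∣A∣≡k} {B = .A , ∣B∣≡k} refl = cong (A ,_) (≡-irrelevant ∣A∣≡k ∣B∣≡k)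

_≟ᵥ_ : ∀ {k} → DecidableEquality (KSubset n k)
A ≟ᵥ B = map′ vertex-≡ (cong proj₁) (≡-dec Bool._≟_ (proj₁ A) (proj₁ B))

johnson-distance : ∀ {k} (A B : KSubset n k) → Dist (Johnson n k) A B (k ∸ ∣ proj₁ A ∩ proj₁ B ∣)
johnson-distance {n} {k} = ρ-is-distance
  where
  ρ : KSubset n k → KSubset n k → ℕ
  ρ A B = k ∸ ∣ proj₁ A ∩ proj₁ B ∣

  ρ-refl : ∀ A → ρ A A ≡ 0
  ρ-refl (A , ∣A∣≡k) = trans (cong (λ s → k ∸ ∣ s ∣) (∩-idem A)) (trans (cong (k ∸_) ∣A∣≡k) (n∸n≡0 k))

  ρ≡0⇒≡ : ∀ A B → ρ A B ≡ 0 → A ≡ B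
  ρ≡0⇒≡ (A , ∣A∣≡k) (B , ∣B∣≡k) ρ≡0 = vertex-≡ (∣p∣⊔∣q∣≤∣p∩q∣⇒p≡q A B
    (subst (λ s → s ≤ ∣ A ∩ B ∣) (sym (trans (cong₂ _⊔_ ∣A∣≡k ∣B∣≡k) (⊔-idem k))) (m∸n≡0⇒m≤n ρ≡0)))

  ρ-descent : ∀ A B {m} → ρ A B ≡ suc m → ∃[ A′ ] (Adj (Johnson n k) A A′ × ρ A′ B ≡ m)
  ρ-descent (A , ∣A∣≡k) (B , ∣B∣≡k) {m} ρ≡m+1 =
    let A′ , ∣A′∣≡∣A∣ , ∣A∩A′∣+1≡∣A∣ , ∣A′∩B∣≡ =
          exchange A B (trans ∣A∣≡k (sym ∣B∣≡k)) ∣A∩B∣<∣A∣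
    in (A′ , trans ∣A′∣≡∣A∣ ∣A∣≡k) , cong pred (trans ∣A∩A′∣+1≡∣A∣ ∣A∣≡k) , (begin
         k ∸ ∣ A′ ∩ B ∣           ≡⟨ cong (k ∸_) ∣A′∩B∣≡ ⟩
         k ∸ suc ∣ A ∩ B ∣        ≡⟨ pred[m∸n]≡m∸[1+n] k ∣ A ∩ B ∣ ⟨
         pred (k ∸ ∣ A ∩ B ∣)     ≡⟨ cong pred ρ≡m+1 ⟩
         m                        ∎)
    where
    open ≡-Reasoning
    ∣A∩B∣<∣A∣ : ∣ A ∩ B ∣ < ∣ A ∣
    ∣A∩B∣<∣A∣ = subst (∣ A ∩ B ∣ <_) (sym ∣A∣≡k) (m∸n≢0⇒n<m (1+n≢0 ∘ trans (sym ρ≡m+1)))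

  ρ-lipschitz : ∀ A W B → Adj (Johnson n k) A W → ρ A B ≤ suc (ρ W B)
  ρ-lipschitz (A , _) (W , ∣W∣≡k) (B , _) ∣A∩W∣≡k∸1 = ∸-lipschitz k
    (subst₂ _≤_ (cong (_+ ∣ W ∩ B ∣) ∣A∩W∣≡k∸1) (cong (_+ ∣ A ∩ B ∣) ∣W∣≡k) (∣p∩q∣+∣q∩r∣≤∣q∣+∣p∩r∣ A W B))

  open DistanceCharacterisation (Johnson n k) ρ ρ-refl ρ≡0⇒≡ ρ-descent ρ-lipschitz

out∷ : ∀ {k} → KSubset n k → KSubset (suc n) k
out∷ (A , ∣A∣≡k) = outside ∷ A , ∣A∣≡k

in∷ : ∀ {k} → KSubset n k → KSubset (suc n) (suc k)
in∷ (A , ∣A∣≡k) = inside ∷ A , cong suc ∣A∣≡k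

out∷-injective : ∀ {k} → Injective _≡_ _≡_ (out∷ {n} {k})
out∷-injective e = vertex-≡ (∷-injectiveʳ (cong proj₁ e))

in∷-injective : ∀ {k} → Injective _≡_ _≡_ (in∷ {n} {k})
in∷-injective e = vertex-≡ (∷-injectiveʳ (cong proj₁ e))

subsets : ∀ n k → List (KSubset n k)
subsets zero    zero    = ([] , refl) ∷ []
subsets zero    (suc k) = []
subsets (suc n) zero    = map out∷ (subsets n zero)
subsets (suc n) (suc k) = map in∷ (subsets n k) ++ map out∷ (subsets n (suc k))

length-subsets : ∀ n k → length (subsets n k) ≡ n C k
length-subsets zero    zero    = refl
length-subsets zero    (suc k) = refl
length-subsets (suc n) zero    = trans (length-map out∷ (subsets n zero)) (length-subsets n zero)
length-subsets (suc n) (suc k) = begin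
  length (map in∷ (subsets n k) ++ map out∷ (subsets n (suc k)))
    ≡⟨ length-++ (map in∷ (subsets n k)) ⟩
  length (map in∷ (subsets n k)) + length (map out∷ (subsets n (suc k)))
    ≡⟨ cong₂ _+_ (length-map in∷ (subsets n k)) (length-map out∷ (subsets n (suc k))) ⟩
  length (subsets n k) + length (subsets n (suc k))
    ≡⟨ cong₂ _+_ (length-subsets n k) (length-subsets n (suc k)) ⟩
  n C k + n C suc k
    ≡⟨ nCk+nC[k+1]≡[n+1]C[k+1] n k ⟩
  suc n C suc k
    ∎
  where open ≡-Reasoning

∈-subsets : ∀ n k (A : KSubset n k) → A ∈ subsets n k
∈-subsets zero    zero    ([] , _)             = here (vertex-≡ refl)
∈-subsets (suc n) zero    (outside ∷ A , ∣A∣≡0) = ∈-map⁺ out∷ (∈-subsets n zero (A , ∣A∣≡0))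
∈-subsets (suc n) (suc k) (inside  ∷ A , ∣A∣≡k) =
  ∈-++⁺ˡ (subst (_∈ map in∷ (subsets n k)) (vertex-≡ refl)
    (∈-map⁺ in∷ (∈-subsets n k (A , suc-injective ∣A∣≡k))))
∈-subsets (suc n) (suc k) (outside ∷ A , ∣A∣≡k) =
  ∈-++⁺ʳ (map in∷ (subsets n k)) (∈-map⁺ out∷ (∈-subsets n (suc k) (A , ∣A∣≡k)))

subsets-unique : ∀ n k → Unique (subsets n k)
subsets-unique zero    zero    = All.[] ∷ []
subsets-unique zero    (suc k) = []
subsets-unique (suc n) zero    = Unique.map⁺ out∷-injective (subsets-unique n zero)
subsets-unique (suc n) (suc k) =
  Unique.++⁺ (Unique.map⁺ in∷-injective (subsets-unique n k))
             (Unique.map⁺ out∷-injective (subsets-unique n (suc k)))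
    λ (A∈ , A∈′) → case (∈-map⁻ in∷ A∈ , ∈-map⁻ out∷ A∈′) of λ where
      ((_ , _ , refl) , (_ , _ , ()))

complement : ∀ {k} → KSubset (2 * k) k → KSubset (2 * k) k
complement {k} (A , ∣A∣≡k) = ∁ A , (begin
  ∣ ∁ A ∣          ≡⟨ ∣∁p∣≡n∸∣p∣ A ⟩
  2 * k ∸ ∣ A ∣    ≡⟨ cong (2 * k ∸_) ∣A∣≡k ⟩
  k + (k + 0) ∸ k  ≡⟨ m+n∸m≡n k (k + 0) ⟩
  k + 0            ≡⟨ +-identityʳ k ⟩
  k                ∎)
  where open ≡-Reasoning

complement-injective : ∀ {k} → Injective _≡_ _≡_ (complement {k})
complement-injective e = vertex-≡ (∁-injective (cong proj₁ e))

equidistant-from-complement⇒2*m≡k : ∀ {k} (A X : KSubset (2 * k) k) {m} →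
  Dist (Johnson (2 * k) k) A X m → Dist (Johnson (2 * k) k) (complement A) X m → 2 * m ≡ k
equidistant-from-complement⇒2*m≡k {k} (A , _) (X , ∣X∣≡k) {m} A↝X ∁A↝X = begin
  2 * m  ≡⟨ m+m≡2*m m ⟨
  m + m  ≡⟨ cong₂ _+_ m≡a m≡b ⟩
  a + b  ≡⟨ a+b≡k ⟩
  k      ∎
  where
  open ≡-Reasoning
  a b : ℕ
  a = ∣ A ∩ X ∣
  b = ∣ ∁ A ∩ X ∣
  a+b≡k : a + b ≡ k
  a+b≡k = trans (cong₂ (λ s t → ∣ s ∣ + ∣ t ∣) (∩-comm A X) (∩-comm (∁ A) X))
                (trans (∣p∩q∣+∣p∩∁q∣≡∣p∣ X A) ∣X∣≡k)
  m≡a : m ≡ a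
  m≡a = trans (Dist-unique ∁A↝X (johnson-distance _ _)) (trans (cong (_∸ b) (sym a+b≡k)) (m+n∸n≡m a b))
  m≡b : m ≡ b
  m≡b = trans (Dist-unique A↝X (johnson-distance _ _)) (trans (cong (_∸ a) (sym a+b≡k)) (m+n∸m≡n a b))

[2k]Ck/2≡[2k∸1]C[k∸1] : ∀ k → .{{NonZero k}} → ((2 * k) C k) / 2 ≡ (2 * k ∸ 1) C (k ∸ 1)
[2k]Ck/2≡[2k∸1]C[k∸1] (suc k′) = begin
  (suc n′ C suc k′) / 2          ≡⟨ cong (_/ 2) (nCk+nC[k+1]≡[n+1]C[k+1] n′ k′) ⟨
  (n′ C k′ + n′ C suc k′) / 2    ≡⟨ cong (λ c → (n′ C k′ + c) / 2) n′C[k′+1]≡n′Ck′ ⟩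
  (n′ C k′ + n′ C k′) / 2        ≡⟨ cong (_/ 2) (trans (m+m≡2*m (n′ C k′)) (*-comm 2 (n′ C k′))) ⟩
  (n′ C k′) * 2 / 2              ≡⟨ m*n/n≡m (n′ C k′) 2 ⟩
  n′ C k′                        ∎
  where
  open ≡-Reasoning
  n′ : ℕ
  n′ = 2 * suc k′ ∸ 1
  n′≡k′+[k′+1] : n′ ≡ k′ + suc k′
  n′≡k′+[k′+1] = cong (λ j → k′ + suc j) (+-identityʳ k′)
  n′C[k′+1]≡n′Ck′ : n′ C suc k′ ≡ n′ C k′
  n′C[k′+1]≡n′Ck′ = trans
    (nCk≡nC[n∸k] (subst (suc k′ ≤_) (sym n′≡k′+[k′+1]) (m≤n+m (suc k′) k′)))
    (cong (n′ C_) (trans (cong (_∸ suc k′) n′≡k′+[k′+1]) (m+n∸n≡m k′ (suc k′))))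

module OddCentralJohnson (h : ℕ) where

  private
    k n′ k′ : ℕ
    k = suc (2 * h)
    n′ = 2 * k ∸ 1
    k′ = k ∸ 1
    J : Graph
    J = Johnson (2 * k) k

  open import Data.List.Membership.DecPropositional (_≟ᵥ_ {2 * k} {k}) using (_∈?_)

  through-first-point : List (V J)
  through-first-point = map in∷ (subsets n′ k′)

  ∈-through-first-point : ∀ A ∣A∣≡k → (inside ∷ A , ∣A∣≡k) ∈ through-first-point
  ∈-through-first-point A ∣A∣≡k =
    subst (_∈ through-first-point) (vertex-≡ refl) (∈-map⁺ in∷ (∈-subsets n′ k′ (A , suc-injective ∣A∣≡k)))

  through-first-point-equalizer : IsDistanceEqualizer J through-first-point
  through-first-point-equalizer (inside ∷ U , ∣U∣≡k) _ U∉ _ _ =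
    contradiction (∈-through-first-point U ∣U∣≡k) U∉
  through-first-point-equalizer (outside ∷ U , _) (inside ∷ W , ∣W∣≡k) _ W∉ _ =
    contradiction (∈-through-first-point W ∣W∣≡k) W∉
  through-first-point-equalizer u@(outside ∷ U , ∣U∣≡k) v@(outside ∷ W , ∣W∣≡k) _ _ _ =
    let Y , ∣Y∣≡2h , ∣U∩Y∣≡∣W∩Y∣ = equalizing-subset U W h (trans ∣U∣≡k (sym ∣W∣≡k)) (m≤m+n (2 * h) _)
        X = in∷ (Y , ∣Y∣≡2h)
    in X , ∈-map⁺ in∷ (∈-subsets n′ k′ _) , k ∸ ∣ U ∩ Y ∣ , johnson-distance u X ,
       subst (λ s → Dist J v X (k ∸ s)) (sym ∣U∩Y∣≡∣W∩Y∣) (johnson-distance v X)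

  meets-complementary-pairs : ∀ S → IsDistanceEqualizer J S → ∀ A → A ∈ S ⊎ complement A ∈ S
  meets-complementary-pairs S equalizer A with A ∈? S | complement A ∈? S
  ... | yes A∈S | _        = inj₁ A∈S
  ... | no _    | yes ∁A∈S = inj₂ ∁A∈S
  ... | no A∉S  | no ∁A∉S  =
    let _ , _ , m , A↝X , ∁A↝X = equalizer A (complement A) A∉S ∁A∉S (p≢∁p _ ∘ cong proj₁)
    in contradiction (equidistant-from-complement⇒2*m≡k A _ A↝X ∁A↝X) (even≢odd m h)

  equalizer-length≥ : ∀ S → IsDistanceEqualizer J S → n′ C k′ ≤ length S
  equalizer-length≥ S equalizer =
    subst (_≤ length S) (length-subsets n′ k′)
      (length≤pair-transversal {ι = in∷} {ι′ = complement ∘ in∷}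
        in∷-injective (in∷-injective ∘ complement-injective) in∷≢complement
        (subsets-unique n′ k′) S (meets-complementary-pairs S equalizer ∘ in∷))
    where
    in∷≢complement : ∀ (A B : KSubset n′ k′) → in∷ A ≢ complement (in∷ B)
    in∷≢complement _ _ e = contradiction (∷-injectiveˡ (cong proj₁ e)) λ ()

  eqdim : EqDim J (((2 * k) C k) / 2)
  eqdim = subst (EqDim J) (sym ([2k]Ck/2≡[2k∸1]C[k∸1] k))
    ( ( through-first-point
      , Unique.map⁺ in∷-injective (subsets-unique n′ k′)
      , through-first-point-equalizer
      , trans (length-map in∷ (subsets n′ k′)) (length-subsets n′ k′))
    , λ S _ → equalizer-length≥ S)

theorem5 : ∀ (k : ℕ) → k % 2 ≡ 1 → 3 ≤ k →
    EqDim (Johnson (2 * k) k) (((2 * k) C k) / 2)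
theorem5 k k%2≡1 _ =
  subst (λ k → EqDim (Johnson (2 * k) k) (((2 * k) C k) / 2)) (sym k≡1+2h) (OddCentralJohnson.eqdim h)
  where
  h : ℕ
  h = k / 2
  k≡1+2h : k ≡ suc (2 * h)
  k≡1+2h = trans (m≡m%n+[m/n]*n k 2) (cong₂ _+_ k%2≡1 (*-comm h 2))
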